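{- Let $H$ be a digraph (possibly with loops), $D$ an $H$-colored digraph with no isolated vertices, $\mathscr{F}$ a walk-preservative $H$-class partition of $A(D)$, and $\mathcal{S}$ an independent and $l$-absorbent set in $C_{\mathscr{F}}(D)$ for some $l\geq 1$. If $K$ is a kernel by paths in $D\langle\bigcup_{F\in\mathcal{S}}F\rangle$, then $K$ is an $(l+1,H)$-absorbent set by walks in $D$, i.e., every $x\in V(D)\setminus K$ has a walk in $D$ to some vertex of $K$ with $H$-length at most $l+1$.
   Context: An $H$-colored digraph is a finite digraph $D$ without loops with a coloring $\rho:A(D)\to V(H)$. For $F\subseteq A(D)$, $D\langle F\rangle$ is the digraph with arc set $F$ and vertex set the vertices incident with an arc of $F$. An $H$-class partition of $A(D)$ is a partition $\mathscr{F}$ of $A(D)$ such that for all arcs $(u,v),(v,w)$ of $D$, $(\rho(u,v),\rho(v,w))\in A(H)$ iff some $F\in\mathscr{F}$ contains both arcs. The $H$-class digraph $C_{\mathscr{F}}(D)$ has vertex set $\mathscr{F}$, and $(F,G)$ (possibly a loop) is an arc iff there exist $(u,v)\in F$ and $(v,w)\in G$. $\mathscr{F}$ is walk-preservative if for every arc $(F,G)$ of $C_{\mathscr{F}}(D)$ and every $z\in V(D\langle F\rangle)$ there is a $zw$-path in $D\langle F\rangle$ for some $w\in V(D\langle G\rangle)$. A set $\mathcal{S}$ in a digraph is independent if there is no arc between two different vertices of $\mathcal{S}$, and $l$-absorbent if every vertex not in $\mathcal{S}$ has a walk of length at most $l$ to a vertex of $\mathcal{S}$. A kernel by paths in a digraph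 is a vertex set $K$ such that there is no path between two different vertices of $K$ and every vertex not in $K$ has a path to a vertex of $K$. For a walk $W=(x_0,\ldots,x_n)$ in $D$, there is an obstruction on $x_i$ if $(\rho(x_{i-1},x_i),\rho(x_i,x_{i+1}))\notin A(H)$; for open $W$, the $H$-length is $1$ plus the number of $i\in\{1,\ldots,n-1\}$ with an obstruction on $x_i$. -}

module Defs where

open import Data.Nat using (ℕ; zero; suc; _+_; _≤_)
open import Data.Fin using (Fin)
open import Data.Fin.Subset using (Subset; _∈_; _∉_)
open import Data.Bool using (Bool; true; false; T; if_then_else_)
open import Data.List using (List; []; _∷_)
open import Data.List.Relation.Unary.Unique.Propositional using (Unique)
open import Data.Product using (Σ; ∃; ∃-syntax; _×_; _,_)
open import Data.Sum using (_⊎_)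
open import Relation.Nullary using (¬_)
open import Relation.Binary.PropositionalEquality using (_≡_; _≢_)

record Digraph : Set where
  field
    n   : ℕ
    adj : Fin n → Fin n → Bool

open Digraph public

V : Digraph → Set
V G = Fin (n G)

Arc : (G : Digraph) → V G → V G → Set
Arc G u v = T (adj G u v)

Loopless : Digraph → Set
Loopless G = ∀ v → adj G v v ≡ false

NoIsolated : Digraph → Set
NoIsolated G = ∀ v → ∃[ u ] (Arc G v u ⊎ Arc G u v)

data Walk {m : ℕ} (R : Fin m → Fin m → Set) : Fin m → Fin m → Set where
  []  : ∀ {x} → Walk R x x
  _∷_ : ∀ {x y z} → R x y → Walk R y z → Walk R x z

infixr 5 _∷_

walkLength : ∀ {m} {R : Fin m → Fin m → Set} {x y} → Walk R x y → ℕ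
walkLength []      = 0
walkLength (_ ∷ w) = suc (walkLength w)

vertices : ∀ {m} {R : Fin m → Fin m → Set} {x y} → Walk R x y → List (Fin m)
vertices ([] {x})      = x ∷ []
vertices (_∷_ {x} _ w) = x ∷ vertices w

IsPath : ∀ {m} {R : Fin m → Fin m → Set} {x y} → Walk R x y → Set
IsPath w = Unique (vertices w)

Path : ∀ {m} (R : Fin m → Fin m → Set) → Fin m → Fin m → Set
Path R x y = Σ (Walk R x y) IsPath

-- H-colored digraphs: colouring ρ of the arcs of D by vertices of H.
-- (ρ is given on all ordered pairs; only its values on arcs matter.)

Coloring : Digraph → Digraph → Set
Coloring D H = V D → V D → V H

obstructions : (D H : Digraph) (ρ : Coloring D H) {x y : V D} →
               Walk (Arc D) x y → ℕ
obstructions D H ρ [] = 0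
obstructions D H ρ (_ ∷ []) = 0
obstructions D H ρ (_∷_ {x} {y} a (_∷_ {y = w} b rest)) =
  (if adj H (ρ x y) (ρ y w) then 0 else 1)
    + obstructions D H ρ (b ∷ rest)

HLength : (D H : Digraph) (ρ : Coloring D H) {x y : V D} →
          Walk (Arc D) x y → ℕ
HLength D H ρ w = suc (obstructions D H ρ w)

-- Partitions of A(D) into k classes: class assignment on arcs,
-- every class nonempty.

ClassMap : Digraph → ℕ → Set
ClassMap D k = V D → V D → Fin k

IsArcPartition : (D : Digraph) {k : ℕ} → ClassMap D k → Set
IsArcPartition D {k} cls = ∀ (F : Fin k) → ∃[ u ] ∃[ v ] (Arc D u v × cls u v ≡ F)

IsHClass : (D H : Digraph) (ρ : Coloring D H) {k : ℕ} → ClassMap D k → Set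
IsHClass D H ρ cls =
  ∀ u v w → Arc D u v → Arc D v w →
    (Arc H (ρ u v) (ρ v w) → cls u v ≡ cls v w) ×
    (cls u v ≡ cls v w → Arc H (ρ u v) (ρ v w))

-- H-class digraph C_F(D) as a relation on Fin k (loops allowed)
ClassArc : (D : Digraph) {k : ℕ} → ClassMap D k → Fin k → Fin k → Set
ClassArc D cls F G =
  ∃[ u ] ∃[ v ] ∃[ w ] (Arc D u v × Arc D v w × cls u v ≡ F × cls v w ≡ G)

ArcIn : (D : Digraph) {k : ℕ} → ClassMap D k → Fin k → V D → V D → Set
ArcIn D cls F u v = Arc D u v × cls u v ≡ F

VertexOf : ∀ {m} → (Fin m → Fin m → Set) → Fin m → Set
VertexOf R z = ∃[ u ] (R z u ⊎ R u z)

WalkPreservative : (D : Digraph) {k : ℕ} → ClassMap D k → Set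
WalkPreservative D cls =
  ∀ F G → ClassArc D cls F G →
    ∀ z → VertexOf (ArcIn D cls F) z →
      ∃[ w ] (VertexOf (ArcIn D cls G) w × Path (ArcIn D cls F) z w)

Independent : ∀ {m} → (Fin m → Fin m → Set) → Subset m → Set
Independent R S = ∀ x y → x ∈ S → y ∈ S → x ≢ y → ¬ R x y

Absorbent : ∀ {m} → (Fin m → Fin m → Set) → ℕ → Subset m → Set
Absorbent R l S =
  ∀ x → x ∉ S → ∃[ y ] (y ∈ S × Σ (Walk R x y) (λ w → walkLength w ≤ l))

ArcInUnion : (D : Digraph) {k : ℕ} → ClassMap D k → Subset k → V D → V D → Set
ArcInUnion D cls S u v = Arc D u v × cls u v ∈ S

-- kernel by paths in the digraph with arc relation R and vertex set
-- the vertices incident with an arc of R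
KernelByPaths : ∀ {m} → (Fin m → Fin m → Set) → Subset m → Set
KernelByPaths R K =
  (∀ x → x ∈ K → VertexOf R x) ×
  (∀ x y → x ∈ K → y ∈ K → x ≢ y → ¬ Path R x y) ×
  (∀ x → VertexOf R x → x ∉ K → ∃[ y ] (y ∈ K × Path R x y))

{-# OPTIONS --safe #-}
module Submission where

-- Call a set of arcs coherent if any two consecutive arcs in it have H-adjacent
-- colours. By the H-class condition each class is coherent, and so is the union of
-- an independent set S of classes: two consecutive arcs lying in classes of S give
-- an arc of C_F(D), which independence forces to be a loop. A walk through coherent
-- arcs has no obstructions, and prefixing one to a walk adds at most one (at the
-- junction). Now let x ∈ D⟨F⟩ and let F = F₀, F₁, …, Fₘ ∈ S be a walk in C_F(D)
-- with m ≤ l. Walk-preservation gives paths in D⟨F₀⟩, …, D⟨Fₘ₋₁⟩ leading into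
-- D⟨Fₘ⟩, and the kernel by paths finishes inside D⟨⋃ S⟩; the concatenation has at
-- most m obstructions, i.e. H-length at most l + 1.

open import Defs
open import Data.Nat using (ℕ; suc; _≤_; _+_; z≤n; s≤s)
open import Data.Nat.Properties using (≤-trans; ≤-reflexive; n≤1+n; +-monoˡ-≤)
open import Data.Fin using (Fin; _≟_)
open import Data.Fin.Subset using (Subset; _∈_; _∉_)
open import Data.Fin.Subset.Properties using (_∈?_)
open import Data.Bool using (true; false; T; if_then_else_)
open import Data.Product using (Σ; ∃-syntax; _×_; _,_; proj₁; proj₂)
open import Data.Sum using (inj₁; inj₂)
open import Relation.Nullary using (yes; no; contradiction)
open import Relation.Binary.PropositionalEquality using (_≡_; refl; sym; trans; subst; cong₂)

if-T-0 : ∀ {b} → T b → (if b then 0 else 1) ≡ 0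
if-T-0 {true} _ = refl

if-≤-1 : ∀ b → (if b then 0 else 1) ≤ 1
if-≤-1 true  = z≤n
if-≤-1 false = s≤s z≤n

absorbent-reach : ∀ {m} {R : Fin m → Fin m → Set} {l S} → Absorbent R l S →
  ∀ x → ∃[ y ] (y ∈ S × Σ (Walk R x y) (λ w → walkLength w ≤ l))
absorbent-reach {S = S} absorbent x with x ∈? S
... | yes x∈S = x , x∈S , [] , z≤n
... | no  x∉S = absorbent x x∉S

module _ (D H : Digraph) (ρ : Coloring D H) where

  ArcWith : (V D → V D → Set) → V D → V D → Set
  ArcWith P u v = Arc D u v × P u v

  Coherent : (V D → V D → Set) → Set
  Coherent P = ∀ {u v w} → ArcWith P u v → ArcWith P v w → Arc H (ρ u v) (ρ v w)

  _▷_ : ∀ {P x y z} → Walk (ArcWith P) x y → Walk (Arc D) y z → Walk (Arc D) x z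
  []      ▷ W = W
  (a ∷ w) ▷ W = proj₁ a ∷ (w ▷ W)

  infixr 5 _▷_

  obstructions-coherent : ∀ {P x y} → Coherent P → (w : Walk (ArcWith P) x y) →
    obstructions D H ρ (w ▷ []) ≡ 0
  obstructions-coherent coh []       = refl
  obstructions-coherent coh (a ∷ []) = refl
  obstructions-coherent coh (a ∷ b ∷ w) =
    cong₂ _+_ (if-T-0 (coh a b)) (obstructions-coherent coh (b ∷ w))

  obstructions-▷ : ∀ {P x y z} → Coherent P → (w : Walk (ArcWith P) x y) (W : Walk (Arc D) y z) →
    obstructions D H ρ (w ▷ W) ≤ suc (obstructions D H ρ W)
  obstructions-▷ coh []       W  = n≤1+n _
  obstructions-▷ coh (a ∷ []) [] = z≤n
  obstructions-▷ coh (_∷_ {u} {v} a []) (_∷_ {y = w} b W) =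
    +-monoˡ-≤ (obstructions D H ρ (b ∷ W)) (if-≤-1 (adj H (ρ u v) (ρ v w)))
  obstructions-▷ coh (a ∷ b ∷ w) W =
    subst (λ c → c + _ ≤ _) (sym (if-T-0 (coh a b))) (obstructions-▷ coh (b ∷ w) W)

  module _ {k : ℕ} (cls : ClassMap D k) (hClass : IsHClass D H ρ cls) where

    class-coherent : ∀ F → Coherent (λ u v → cls u v ≡ F)
    class-coherent F {u} {v} {w} (uv , uv∈F) (vw , vw∈F) =
      proj₂ (hClass u v w uv vw) (trans uv∈F (sym vw∈F))

    independent-coherent : ∀ {S} → Independent (ClassArc D cls) S → Coherent (λ u v → cls u v ∈ S)
    independent-coherent indep {u} {v} {w} (uv , uv∈S) (vw , vw∈S) with cls u v ≟ cls v w
    ... | yes same = proj₂ (hClass u v w uv vw) same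
    ... | no  diff = contradiction (u , v , w , uv , vw , refl , refl) (indep _ _ uv∈S vw∈S diff)

    vertex-of-union : ∀ {F S z} → F ∈ S → VertexOf (ArcIn D cls F) z → VertexOf (ArcInUnion D cls S) z
    vertex-of-union F∈S (u , inj₁ (zu , zu∈F)) = u , inj₁ (zu , subst (_∈ _) (sym zu∈F) F∈S)
    vertex-of-union F∈S (u , inj₂ (uz , uz∈F)) = u , inj₂ (uz , subst (_∈ _) (sym uz∈F) F∈S)

    reach-kernel : ∀ {S K} → WalkPreservative D cls → Independent (ClassArc D cls) S →
      KernelByPaths (ArcInUnion D cls S) K →
      ∀ {F G} (cw : Walk (ClassArc D cls) F G) → G ∈ S →
      ∀ z → VertexOf (ArcIn D cls F) z →
      ∃[ y ] (y ∈ K × Σ (Walk (Arc D) z y) (λ W → obstructions D H ρ W ≤ walkLength cw))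
    reach-kernel {K = K} walkPres indep (_ , _ , absorbs) [] G∈S z z∈G with z ∈? K
    ... | yes z∈K = z , z∈K , [] , z≤n
    ... | no  z∉K with absorbs z (vertex-of-union G∈S z∈G) z∉K
    ... | y , y∈K , (w , _) =
      y , y∈K , w ▷ [] , ≤-reflexive (obstructions-coherent (independent-coherent indep) w)
    reach-kernel walkPres indep kernel (FG ∷ cw) G∈S z z∈F with walkPres _ _ FG z z∈F
    ... | z′ , z′∈G , (w , _) with reach-kernel walkPres indep kernel cw G∈S z′ z′∈G
    ... | y , y∈K , W , obs≤ =
      y , y∈K , w ▷ W , ≤-trans (obstructions-▷ (class-coherent _) w W) (s≤s obs≤)

incident-class : ∀ {D k} (cls : ClassMap D k) → NoIsolated D →
  ∀ x → ∃[ F ] VertexOf (ArcIn D cls F) x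
incident-class cls noIsolated x with noIsolated x
... | u , inj₁ xu = cls x u , u , inj₁ (xu , refl)
... | u , inj₂ ux = cls u x , u , inj₂ (ux , refl)

proposition1 : (H D : Digraph) (ρ : Coloring D H) (k : ℕ) (cls : ClassMap D k)
    (S : Subset k) (l : ℕ) (K : Subset (n D)) →
    Loopless D → NoIsolated D →
    IsArcPartition D cls → IsHClass D H ρ cls → WalkPreservative D cls →
    Independent (ClassArc D cls) S → Absorbent (ClassArc D cls) l S → 1 ≤ l →
    KernelByPaths (ArcInUnion D cls S) K →
    ∀ x → x ∉ K →
      ∃[ y ] (y ∈ K × Σ (Walk (Arc D) x y) (λ w → HLength D H ρ w ≤ suc l))
proposition1 H D ρ k cls S l K _ noIsolated _ hClass walkPres indep absorbent _ kernel x _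
  with incident-class cls noIsolated x
... | F , x∈F with absorbent-reach absorbent F
... | G , G∈S , cw , |cw|≤l with reach-kernel D H ρ cls hClass walkPres indep kernel cw G∈S x x∈F
... | y , y∈K , W , obs≤|cw| = y , y∈K , W , s≤s (≤-trans obs≤|cw| |cw|≤l)
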